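{- Let $\pi\in\mathfrak{S}_n$ with rix-factorization $\pi=\alpha_1\cdots\alpha_k\beta$. If $y$ is a leading descent of $\pi$, then either $y$ is a letter of $\beta$ or $y$ is the last letter of $\alpha_i$ for some $1\le i\le k$.
   Context: One-line notation; a letter $\pi_i$ ($i\in[n-1]$) is a descent if $\pi_i>\pi_{i+1}$. A descent $y$ of $\pi$ is a leading descent if no descent of $\pi$ larger than $y$ appears after $y$. Rix-factorization $\pi=\alpha_1\cdots\alpha_k\beta$: (1) $w:=\pi$, $i:=0$; (2) if $w$ increasing, $\beta:=w$, stop; else $i:=i+1$, let $x$ be the largest descent of the word $w$, write $w=w'xw''$; (3) if $w'$ empty, $\beta:=w$, stop; else $\alpha_i:=w'x$, $w:=w''$, go to (2). -}

module Defs where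

open import Data.Nat using (ℕ; zero; suc; _<_; _≤_; _<ᵇ_; _≡ᵇ_; _⊔_)
open import Data.Bool using (Bool; true; false; if_then_else_)
open import Data.List using (List; []; _∷_; _++_; [_]; length; map; upTo; breakᵇ)
open import Data.List.Membership.Propositional using (_∈_)
open import Data.Product using (_×_; _,_; ∃-syntax)
open import Relation.Binary.PropositionalEquality using (_≡_)
open import Data.List.Relation.Binary.Permutation.Propositional using (_↭_)

-- π ∈ 𝔖ₙ in one-line notation: a list that is a rearrangement of 1,2,…,n
IsPerm : ℕ → List ℕ → Set
IsPerm n π = π ↭ map suc (upTo n)

IsDescent : List ℕ → ℕ → Set
IsDescent w y = ∃[ u ] ∃[ v ] ∃[ z ] (w ≡ u ++ y ∷ z ∷ v × z < y)

IsLeadingDescent : List ℕ → ℕ → Set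
IsLeadingDescent π y =
  IsDescent π y ×
  (∀ u v → π ≡ u ++ y ∷ v → ∀ z → z ∈ v → IsDescent π z → z ≤ y)

descents : List ℕ → List ℕ
descents [] = []
descents (a ∷ []) = []
descents (a ∷ b ∷ w) = if b <ᵇ a then a ∷ descents (b ∷ w) else descents (b ∷ w)

maxList : List ℕ → ℕ
maxList [] = 0
maxList (a ∷ w) = a ⊔ maxList w

-- Rix-factorization step loop, with fuel (fuel = length w suffices, since
-- the remaining word strictly shrinks at every step).
-- Returns (list of α's, β).
rixAux : ℕ → List ℕ → List (List ℕ) × List ℕ
rixAux zero w = [] , w
rixAux (suc f) w with descents w
... | [] = [] , w                                  -- w increasing: β := w
... | d ∷ ds with breakᵇ (λ a → a ≡ᵇ maxList (d ∷ ds)) w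
...   | [] , _ = [] , w                            -- w' empty: β := w
...   | (a ∷ w') , [] = [] , w                      -- unreachable (x occurs in w)
...   | (a ∷ w') , (x ∷ w'') with rixAux f w''
...     | αs , β = ((a ∷ w') ++ [ x ]) ∷ αs , β

rix : List ℕ → List (List ℕ) × List ℕ
rix π = rixAux (length π) π

-- Rix's procedure cuts the word after the first occurrence of its largest
-- descent x. A leading descent y is never cut into the prefix before x: x is
-- a descent, so if it occurred after y it would have to be ≤ y, while y ≤ x
-- since x is the largest descent; hence x = y, contradicting that x occurs
-- first. So y is either the cut letter itself, i.e. the last letter of some αᵢ,
-- or it survives into the remaining suffix, where it is still a leading
-- descent, and finally lands in β.
module Submission where

open import Defs
open import Data.Nat using (ℕ; zero; suc; _≤_; _<ᵇ_; _≡ᵇ_; _⊔_)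
open import Data.Nat.Properties
  using (≤-trans; ≤-antisym; m≤m⊔n; m≤n⊔m; ⊔-sel; ⊔-identityʳ; <⇒<ᵇ; <ᵇ⇒<; ≡ᵇ⇒≡; ≡⇒≡ᵇ)
open import Data.Bool using (Bool; true; false; T; T?)
open import Data.List using (List; []; _∷_; _++_; [_]; last; head; length; breakᵇ; takeWhile; dropWhile)
open import Data.List.Properties using (++-assoc; ∷-injective; takeWhile++dropWhile; span-defn)
open import Data.List.Membership.Propositional using (_∈_)
open import Data.List.Membership.Propositional.Properties using (∈-++⁺ʳ)
open import Data.List.Relation.Unary.All as All using (All)
open import Data.List.Relation.Unary.All.Properties using (all-takeWhile; all-head-dropWhile)
open import Data.List.Relation.Unary.Any using (Any; here; there)
open import Data.Maybe using (just)
import Data.Maybe.Relation.Unary.All as Maybe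
open import Data.Product using (_×_; _,_; ∃-syntax; proj₁; proj₂)
open import Data.Sum using (_⊎_; inj₁; inj₂; [_,_]′; map₂)
open import Function using (_∘_)
open import Relation.Nullary using (¬_; ¬?; contradiction)
open import Relation.Nullary.Decidable using (decidable-stable)
open import Relation.Binary.PropositionalEquality using (_≡_; refl; sym; trans; cong; cong₂; subst)

private
  variable
    A : Set

breakᵇ-split : (p : A → Bool) (w : List A) {pre suf : List A} {x : A} →
  breakᵇ p w ≡ (pre , x ∷ suf) →
  w ≡ pre ++ x ∷ suf × All (λ a → ¬ T (p a)) pre × T (p x)
breakᵇ-split p w brk = w≡ , prefix , px
  where
  Q? = λ a → ¬? (T? (p a))
  span≡ = trans (sym brk) (span-defn Q? w)
  w≡ = trans (sym (takeWhile++dropWhile Q? w)) (cong₂ _++_ (sym (cong proj₁ span≡)) (sym (cong proj₂ span≡)))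
  prefix = subst (All _) (sym (cong proj₁ span≡)) (all-takeWhile Q? w)
  px : T (p _)
  px with Maybe.just ¬¬px ← subst (Maybe.All _ ∘ head) (sym (cong proj₂ span≡)) (all-head-dropWhile Q? w)
    = decidable-stable (T? (p _)) ¬¬px

last-∷ʳ : (xs : List A) (x : A) → last (xs ++ [ x ]) ≡ just x
last-∷ʳ []           x = refl
last-∷ʳ (_ ∷ [])     x = refl
last-∷ʳ (_ ∷ y ∷ xs) x = last-∷ʳ (y ∷ xs) x

++-∷-split : (q p : List A) {y x : A} {s r : List A} → q ++ y ∷ s ≡ p ++ x ∷ r →
  (y ∈ p × x ∈ s) ⊎ (q ≡ p × y ≡ x) ⊎ ∃[ q′ ] (q ≡ p ++ x ∷ q′ × r ≡ q′ ++ y ∷ s)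
++-∷-split []      []      refl = inj₂ (inj₁ (refl , refl))
++-∷-split []      (a ∷ p) refl = inj₁ (here refl , ∈-++⁺ʳ p (here refl))
++-∷-split (b ∷ q) []      refl = inj₂ (inj₂ (q , refl , refl))
++-∷-split (b ∷ q) (a ∷ p) eq with refl , eq′ ← ∷-injective eq with ++-∷-split q p eq′
... | inj₁ (y∈p , x∈s)              = inj₁ (there y∈p , x∈s)
... | inj₂ (inj₁ (refl , y≡x))      = inj₂ (inj₁ (refl , y≡x))
... | inj₂ (inj₂ (q′ , refl , r≡))  = inj₂ (inj₂ (q′ , refl , r≡))

maxList-∈ : {y : ℕ} (xs : List ℕ) → y ∈ xs → maxList xs ∈ xs
maxList-∈ (x ∷ [])     _ = here (⊔-identityʳ x)
maxList-∈ (x ∷ y ∷ xs) _ with maxList (y ∷ xs) | maxList-∈ (y ∷ xs) (here refl)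
... | m | m∈ = [ here , (λ x⊔m≡m → there (subst (_∈ y ∷ xs) (sym x⊔m≡m) m∈)) ]′ (⊔-sel x m)

≤-maxList : {y : ℕ} {xs : List ℕ} → y ∈ xs → y ≤ maxList xs
≤-maxList {xs = x ∷ xs} (here refl) = m≤m⊔n x (maxList xs)
≤-maxList {xs = x ∷ xs} (there y∈) = ≤-trans (≤-maxList y∈) (m≤n⊔m x (maxList xs))

IsDescent-++ : ∀ p {w y} → IsDescent w y → IsDescent (p ++ w) y
IsDescent-++ p (u , v , z , refl , z<y) = p ++ u , v , z , sym (++-assoc p u _) , z<y

IsDescent-∈ : ∀ {w y} → IsDescent w y → y ∈ w
IsDescent-∈ (u , _ , _ , refl , _) = ∈-++⁺ʳ u (here refl)

∈-descents⁻ : ∀ w {y} → y ∈ descents w → IsDescent w y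
∈-descents⁻ (a ∷ b ∷ w) y∈ with b <ᵇ a | <ᵇ⇒< b a | ∈-descents⁻ (b ∷ w)
... | true  | b<a | ih with y∈
...   | here refl = [] , w , b , refl , b<a _
...   | there y∈′ = IsDescent-++ [ a ] (ih y∈′)
∈-descents⁻ (a ∷ b ∷ w) y∈ | false | _ | ih = IsDescent-++ [ a ] (ih y∈)

descents-∷⁺ : ∀ a w {y} → y ∈ descents w → y ∈ descents (a ∷ w)
descents-∷⁺ a (b ∷ w) y∈ with b <ᵇ a
... | true  = there y∈
... | false = y∈

∈-descents⁺ : ∀ {w y} → IsDescent w y → y ∈ descents w
∈-descents⁺ {y = y} (u , v , z , refl , z<y) = go u
  where
  go : ∀ q → y ∈ descents (q ++ y ∷ z ∷ v)
  go [] with z <ᵇ y | <⇒<ᵇ z<y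
  ... | true | _ = here refl
  go (a ∷ q) = descents-∷⁺ a (q ++ y ∷ z ∷ v) (go q)

largestDescent : List ℕ → ℕ
largestDescent w = maxList (descents w)

largestDescent-isDescent : ∀ {w y} → IsDescent w y → IsDescent w (largestDescent w)
largestDescent-isDescent {w} d = ∈-descents⁻ w (maxList-∈ (descents w) (∈-descents⁺ d))

≤-largestDescent : ∀ {w y} → IsDescent w y → y ≤ largestDescent w
≤-largestDescent d = ≤-maxList (∈-descents⁺ d)

largestDescent-after-leading : ∀ {w y} q s → IsLeadingDescent w y →
  w ≡ q ++ y ∷ s → largestDescent w ∈ s → largestDescent w ≡ y
largestDescent-after-leading q s (d , later≤y) w≡ x∈s =
  ≤-antisym (later≤y q s w≡ _ x∈s (largestDescent-isDescent d)) (≤-largestDescent d)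

IsLeadingDescent-suffix : ∀ p {w w″ y} → IsLeadingDescent w y → w ≡ p ++ w″ →
  IsDescent w″ y → IsLeadingDescent w″ y
IsLeadingDescent-suffix p (_ , later≤y) refl d = d , λ where
  u v refl z z∈v z-desc → later≤y (p ++ u) v (sym (++-assoc p u _)) z z∈v (IsDescent-++ p z-desc)

InβOrEndsα : ℕ → List (List ℕ) × List ℕ → Set
InβOrEndsα y (αs , β) = y ∈ β ⊎ Any (λ α → last α ≡ just y) αs

rixAux-leadingDescent : ∀ f w {y} → IsLeadingDescent w y → InβOrEndsα y (rixAux f w)
rixAux-leadingDescent zero w ld = inj₁ (IsDescent-∈ (proj₁ ld))
rixAux-leadingDescent (suc f) w ld with descents w in ds≡
... | [] = inj₁ (IsDescent-∈ (proj₁ ld))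
... | d ∷ ds with breakᵇ (λ a → a ≡ᵇ maxList (d ∷ ds)) w in brk
...   | [] , _ = inj₁ (IsDescent-∈ (proj₁ ld))
...   | _ ∷ _ , [] = inj₁ (IsDescent-∈ (proj₁ ld))
...   | a ∷ w′ , x ∷ w″
  with w≡ , ¬prefix , x≡ᵇ ← breakᵇ-split (λ a → a ≡ᵇ maxList (d ∷ ds)) w brk
  with q , r , z , w≡′ , z<y ← proj₁ ld
  with ++-∷-split q (a ∷ w′) (trans (sym w≡′) w≡)
... | inj₂ (inj₁ (_ , refl)) = inj₂ (here (last-∷ʳ (a ∷ w′) x))
... | inj₂ (inj₂ (q′ , _ , w″≡)) = map₂ there (rixAux-leadingDescent f w″ ld″)
  where
  ld″ = IsLeadingDescent-suffix ((a ∷ w′) ++ [ x ]) ld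
          (trans w≡ (sym (++-assoc (a ∷ w′) [ x ] w″))) (q′ , r , z , w″≡ , z<y)
... | inj₁ (y∈prefix , x∈suffix) =
  contradiction (≡⇒≡ᵇ _ _ y≡m) (All.lookup ¬prefix y∈prefix)
  where
  m≡ : largestDescent w ≡ maxList (d ∷ ds)
  m≡ = cong maxList ds≡
  x≡m : x ≡ largestDescent w
  x≡m = trans (≡ᵇ⇒≡ x _ x≡ᵇ) (sym m≡)
  y≡m : _ ≡ maxList (d ∷ ds)
  y≡m = trans (sym (largestDescent-after-leading q (z ∷ r) ld w≡′ (subst (_∈ z ∷ r) x≡m x∈suffix))) m≡

lemma20 : (n : ℕ) (π : List ℕ) → IsPerm n π →
    (αs : List (List ℕ)) (β : List ℕ) → rix π ≡ (αs , β) →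
    (y : ℕ) → IsLeadingDescent π y →
    y ∈ β ⊎ Any (λ α → last α ≡ just y) αs
lemma20 _ π _ αs β rix≡ y ld = subst (InβOrEndsα y) rix≡ (rixAux-leadingDescent (length π) π ld)
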